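{- Let $P$ be a finite poset and $I\in\mathcal{IC}(P)$. If $x\in P$ is incomparable to every element of $I$, then $x\in\mathrm{Row}(I)$.
   Context: A subset $I\subseteq P$ is interval-closed if whenever $x,y\in I$ and $x\le z\le y$, then $z\in I$; $\mathcal{IC}(P)$ is the set of interval-closed subsets. For $x\in P$, the toggle $t_x$ sends $I$ to $I\triangle\{x\}$ if this set is interval-closed, and to $I$ otherwise. Rowmotion is $\mathrm{Row}=t_{x_1}\circ\cdots\circ t_{x_N}$ for a linear extension $(x_1,\dots,x_N)$ of $P$ (independent of the choice). -}

module Defs where

open import Level using (Level)
open import Data.Nat using (ℕ)
open import Data.Fin using (Fin)
import Data.Fin as F
open import Data.Fin.Properties using (all?)
open import Data.Fin.Subset using (Subset; _∈_)
open import Data.Fin.Subset.Properties using (_∈?_)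
open import Data.Bool using (not)
open import Data.Vec using (Vec; lookup; toList; updateAt)
open import Data.List using (foldr)
open import Data.Product using (_×_)
open import Relation.Nullary using (¬_; Dec; yes; no)
open import Relation.Nullary.Decidable using (_→-dec_)
open import Relation.Binary using (Rel; Decidable)
open import Relation.Binary.PropositionalEquality using (_≡_)
open import Function.Definitions using (Injective)

-- A finite poset is a decidable partial order _≤_ on Fin n.
-- Subsets of P are  Subset n  (characteristic vectors).

module _ {n : ℕ} {ℓ : Level} (_≤_ : Rel (Fin n) ℓ) (_≤?_ : Decidable _≤_) where

  IntervalClosed : Subset n → Set ℓ
  IntervalClosed I = ∀ x y z → x ∈ I → y ∈ I → x ≤ z → z ≤ y → z ∈ I

  IntervalClosed? : (I : Subset n) → Dec (IntervalClosed I)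
  IntervalClosed? I =
    all? λ x → all? λ y → all? λ z →
      (x ∈? I) →-dec ((y ∈? I) →-dec ((x ≤? z) →-dec ((z ≤? y) →-dec (z ∈? I))))

  flipAt : Fin n → Subset n → Subset n
  flipAt x I = updateAt I x not

  toggle : Fin n → Subset n → Subset n
  toggle x I with IntervalClosed? (flipAt x I)
  ... | yes _ = flipAt x I
  ... | no  _ = I

  record LinearExtension : Set ℓ where
    field
      order     : Vec (Fin n) n
      injective : Injective _≡_ _≡_ (lookup order)
      monotone  : ∀ i j → lookup order i ≤ lookup order j → i F.≤ j

  -- Row = t_{x_1} ∘ ... ∘ t_{x_N}  (t_{x_N} applied first)
  rowmotion : LinearExtension → Subset n → Subset n
  rowmotion L I = foldr toggle I (toList (LinearExtension.order L))

  Incomparable : Fin n → Fin n → Set ℓ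
  Incomparable x y = ¬ (x ≤ y) × ¬ (y ≤ x)

-- Rowmotion toggles from the top of the linear extension down, so the elements already toggled
-- form an up-set U.  Elements strictly above x are not in I, and the invariant is that such an
-- element of U lies in the current set as soon as some element above it does.  When the next
-- element a ≥ x comes up, a is not in the current set, and adding it keeps the set
-- interval-closed as long as nothing between a and a member of the set is missing.  Above a this
-- holds by the invariant, everything strictly between lying in U strictly above x.  Below a it
-- holds when a > x and some member b lies above a (interval-closedness, as w ≤ a ≤ b), and when
-- a = x since then no member lies below x (it would be untoggled, hence in I, hence comparable to
-- x).  So the invariant is kept and x is toggled in; later toggles concern other elements.
module Submission where

open import Defs
open import Level using (Level)
open import Data.Nat using (ℕ)
open import Data.Fin using (Fin)
open import Data.Fin.Subset using (Subset; _∈_)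
open import Relation.Binary using (Rel; IsDecPartialOrder)
open import Relation.Binary.PropositionalEquality using (_≡_)

open import Data.Bool using (true; false; not)
open import Data.Empty using (⊥-elim)
open import Data.Fin using (_≟_; punchOut)
open import Data.Fin.Properties using (any?; punchOut-injective; <⇒notInjective)
open import Data.Fin.Subset using (_∉_)
open import Data.List as List using (List; []; _∷_; foldr)
open import Data.List.Membership.Propositional using () renaming (_∈_ to _∈ₗ_)
open import Data.List.Relation.Unary.All as All using (All)
open import Data.List.Relation.Unary.AllPairs using (AllPairs; []; _∷_)
open import Data.List.Relation.Unary.AllPairs.Properties using (tabulate⁺-<)
open import Data.List.Relation.Unary.Any using (here; there)
open import Data.Nat.Properties using (n<1+n; <⇒≱)
open import Data.Product using (∃; _,_; proj₁; proj₂)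
open import Data.Sum as Sum using (_⊎_; inj₁; inj₂)
open import Data.Vec using (Vec; lookup; toList)
open import Data.Vec.Membership.Propositional.Properties using (∈-lookup; ∈-toList⁺)
open import Data.Vec.Properties using (lookup⇒[]=; []=⇒lookup; lookup∘updateAt; lookup∘updateAt′; updateAt-minimal)
open import Function.Definitions using (Injective)
open import Relation.Binary using (Decidable)
open import Relation.Nullary using (¬_; yes; no; contradiction)
open import Relation.Binary.PropositionalEquality using (refl; sym; trans; cong; subst; _≢_)
open import Function using (_∘_)

injective⇒surjective : ∀ {n} {f : Fin n → Fin n} → Injective _≡_ _≡_ f → ∀ y → ∃ λ i → f i ≡ y
injective⇒surjective {ℕ.suc m} {f} f-inj y with any? (λ i → f i ≟ y)
... | yes hit = hit
... | no miss = ⊥-elim (<⇒notInjective (n<1+n m) punchOut∘f-injective)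
  where
  y≢f : ∀ i → y ≢ f i
  y≢f i y≡fi = miss (i , sym y≡fi)

  punchOut∘f-injective : Injective _≡_ _≡_ (λ i → punchOut (y≢f i))
  punchOut∘f-injective eq = f-inj (punchOut-injective (y≢f _) (y≢f _) eq)

toList≡tabulate∘lookup : ∀ {a} {A : Set a} {m} (v : Vec A m) → toList v ≡ List.tabulate (lookup v)
toList≡tabulate∘lookup Vec.[]      = refl
toList≡tabulate∘lookup (x Vec.∷ v) = cong (x ∷_) (toList≡tabulate∘lookup v)

module _ {n : ℕ} {ℓ : Level} {_≤_ : Rel (Fin n) ℓ} (_≤?_ : Decidable _≤_) where

  ∈-flipAt⁺ : ∀ {a y J} → y ≢ a → y ∈ J → y ∈ flipAt _≤_ _≤?_ a J
  ∈-flipAt⁺ {a} {y} {J} y≢a = updateAt-minimal y a J y≢a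

  ∈-flipAt⁻ : ∀ {a y J} → y ≢ a → y ∈ flipAt _≤_ _≤?_ a J → y ∈ J
  ∈-flipAt⁻ {a} {y} {J} y≢a y∈ =
    lookup⇒[]= y J (trans (sym (lookup∘updateAt′ y a y≢a J)) ([]=⇒lookup y∈))

  ∉⇒∈-flipAt : ∀ {a J} → a ∉ J → a ∈ flipAt _≤_ _≤?_ a J
  ∉⇒∈-flipAt {a} {J} a∉J with lookup J a in eq
  ... | true  = contradiction (lookup⇒[]= a J eq) a∉J
  ... | false = lookup⇒[]= a _ (trans (lookup∘updateAt a J) (cong not eq))

  toggle-intervalClosed : ∀ {a J} → IntervalClosed _≤_ _≤?_ J →
                          IntervalClosed _≤_ _≤?_ (toggle _≤_ _≤?_ a J)
  toggle-intervalClosed {a} {J} J-closed with IntervalClosed? _≤_ _≤?_ (flipAt _≤_ _≤?_ a J)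
  ... | yes flip-closed = flip-closed
  ... | no  _           = J-closed

  ∈-toggle⁺ : ∀ {a y J} → y ≢ a → y ∈ J → y ∈ toggle _≤_ _≤?_ a J
  ∈-toggle⁺ {a} {y} {J} y≢a y∈J with IntervalClosed? _≤_ _≤?_ (flipAt _≤_ _≤?_ a J)
  ... | yes _ = ∈-flipAt⁺ y≢a y∈J
  ... | no  _ = y∈J

  ∈-toggle⁻ : ∀ {a y J} → y ≢ a → y ∈ toggle _≤_ _≤?_ a J → y ∈ J
  ∈-toggle⁻ {a} {y} {J} y≢a y∈ with IntervalClosed? _≤_ _≤?_ (flipAt _≤_ _≤?_ a J)
  ... | yes _ = ∈-flipAt⁻ y≢a y∈
  ... | no  _ = y∈

  ∈-toggle-self : ∀ {a J} → a ∉ J → IntervalClosed _≤_ _≤?_ (flipAt _≤_ _≤?_ a J) →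
                  a ∈ toggle _≤_ _≤?_ a J
  ∈-toggle-self {a} {J} a∉J flip-closed with IntervalClosed? _≤_ _≤?_ (flipAt _≤_ _≤?_ a J)
  ... | yes _ = ∉⇒∈-flipAt a∉J
  ... | no  ¬flip-closed = contradiction flip-closed ¬flip-closed

module _ {n : ℕ} {ℓ : Level} {_≤_ : Rel (Fin n) ℓ} (isPO : IsDecPartialOrder _≡_ _≤_) where
  open IsDecPartialOrder isPO using (_≤?_; antisym) renaming (refl to ≤-refl; trans to ≤-trans)
  open import Relation.Binary.Construct.NonStrictToStrict _≡_ _≤_ using (_<_)

  flipAt-intervalClosed : ∀ {a J} → IntervalClosed _≤_ _≤?_ J → a ∉ J →
                          (∀ {p w} → p ∈ J → p ≤ w → w < a → w ∈ J) →
                          (∀ {q w} → q ∈ J → a < w → w ≤ q → w ∈ J) →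
                          IntervalClosed _≤_ _≤?_ (flipAt _≤_ _≤?_ a J)
  flipAt-intervalClosed {a} J-closed a∉J below above p q w p∈ q∈ p≤w w≤q
    with w ≟ a | p ≟ a | q ≟ a
  ... | yes refl | _        | _        = ∉⇒∈-flipAt _≤?_ a∉J
  ... | no w≢a   | yes refl | yes refl = contradiction (antisym w≤q p≤w) w≢a
  ... | no w≢a   | no p≢a   | yes refl =
    ∈-flipAt⁺ _≤?_ w≢a (below (∈-flipAt⁻ _≤?_ p≢a p∈) p≤w (w≤q , w≢a))
  ... | no w≢a   | yes refl | no q≢a   =
    ∈-flipAt⁺ _≤?_ w≢a (above (∈-flipAt⁻ _≤?_ q≢a q∈) (p≤w , w≢a ∘ sym) w≤q)
  ... | no w≢a   | no p≢a   | no q≢a   =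
    ∈-flipAt⁺ _≤?_ w≢a (J-closed p q w (∈-flipAt⁻ _≤?_ p≢a p∈) (∈-flipAt⁻ _≤?_ q≢a q∈) p≤w w≤q)

  IsLinearExtension : List (Fin n) → Set ℓ
  IsLinearExtension = AllPairs (λ a b → ¬ b ≤ a)

  UpClosed : List (Fin n) → Set ℓ
  UpClosed xs = ∀ {a w} → a ∈ₗ xs → a ≤ w → w ∈ₗ xs

  ∈-tail⇒≢head : ∀ {a y xs} → All (λ b → ¬ b ≤ a) xs → y ∈ₗ xs → y ≢ a
  ∈-tail⇒≢head a-minimal y∈xs refl = All.lookup a-minimal y∈xs ≤-refl

  UpClosed-tail : ∀ {a xs} → All (λ b → ¬ b ≤ a) xs → UpClosed (a ∷ xs) → UpClosed xs
  UpClosed-tail a-minimal up b∈xs b≤w with up (there b∈xs) b≤w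
  ... | here refl  = contradiction b≤w (All.lookup a-minimal b∈xs)
  ... | there w∈xs = w∈xs

  linearExtension-isLinearExtension : (L : LinearExtension _≤_ _≤?_) →
                                      IsLinearExtension (toList (LinearExtension.order L))
  linearExtension-isLinearExtension L =
    subst IsLinearExtension (sym (toList≡tabulate∘lookup order))
      (tabulate⁺-< λ i<j order[j]≤order[i] → <⇒≱ i<j (monotone _ _ order[j]≤order[i]))
    where open LinearExtension L

  linearExtension-complete : (L : LinearExtension _≤_ _≤?_) → ∀ y → y ∈ₗ toList (LinearExtension.order L)
  linearExtension-complete L y with injective⇒surjective (LinearExtension.injective L) y
  ... | i , refl = ∈-toList⁺ (∈-lookup i (LinearExtension.order L))

  module _ (I : Subset n) (I-closed : IntervalClosed _≤_ _≤?_ I) (x : Fin n)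
           (x∥I : ∀ y → y ∈ I → Incomparable _≤_ _≤?_ x y) where

    toggleAll : List (Fin n) → Subset n
    toggleAll = foldr (toggle _≤_ _≤?_) I

    record Invariant (xs : List (Fin n)) : Set ℓ where
      field
        closed             : IntervalClosed _≤_ _≤?_ (toggleAll xs)
        toggled-or-initial : ∀ {y} → y ∈ toggleAll xs → y ∈ₗ xs ⊎ y ∈ I
        downClosed-above-x : ∀ {z b} → z ∈ₗ xs → x < z → z ≤ b → b ∈ toggleAll xs → z ∈ toggleAll xs

    head-toggled-in : ∀ {a xs} → All (λ b → ¬ b ≤ a) xs → UpClosed (a ∷ xs) → Invariant xs → x ≤ a →
                      (∀ {p w} → p ∈ toggleAll xs → p ≤ w → w < a → w ∈ toggleAll xs) →
                      a ∈ toggleAll (a ∷ xs)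
    head-toggled-in {a} {xs} a-minimal up inv x≤a below =
      ∈-toggle-self _≤?_ a∉ (flipAt-intervalClosed closed a∉ below above)
      where
      open Invariant inv

      a∉ : a ∉ toggleAll xs
      a∉ a∈ with toggled-or-initial a∈
      ... | inj₁ a∈xs = ∈-tail⇒≢head a-minimal a∈xs refl
      ... | inj₂ a∈I  = proj₁ (x∥I a a∈I) x≤a

      above : ∀ {q w} → q ∈ toggleAll xs → a < w → w ≤ q → w ∈ toggleAll xs
      above {q} {w} q∈ (a≤w , a≢w) w≤q = downClosed-above-x w∈xs x<w w≤q q∈
        where
        w∈xs : w ∈ₗ xs
        w∈xs with up (here refl) a≤w
        ... | here w≡a   = contradiction (sym w≡a) a≢w
        ... | there w∈xs = w∈xs

        x<w : x < w
        x<w = ≤-trans x≤a a≤w , λ { refl → a≢w (antisym a≤w x≤a) }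

    invariant : ∀ {xs} → IsLinearExtension xs → UpClosed xs → Invariant xs
    invariant [] _ = record
      { closed = I-closed ; toggled-or-initial = inj₂ ; downClosed-above-x = λ () }
    invariant {a ∷ xs} (a-minimal ∷ xs-linear) up = record
      { closed             = toggle-intervalClosed _≤?_ closed
      ; toggled-or-initial = toggled-or-initial′
      ; downClosed-above-x = downClosed-above-x′
      }
      where
      inv = invariant xs-linear (UpClosed-tail a-minimal up)
      open Invariant inv

      toggled-or-initial′ : ∀ {y} → y ∈ toggleAll (a ∷ xs) → y ∈ₗ a ∷ xs ⊎ y ∈ I
      toggled-or-initial′ {y} y∈ with y ≟ a
      ... | yes refl = inj₁ (here refl)
      ... | no  y≢a  = Sum.map₁ there (toggled-or-initial (∈-toggle⁻ _≤?_ y≢a y∈))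

      downClosed-above-x′ : ∀ {z b} → z ∈ₗ a ∷ xs → x < z → z ≤ b →
                            b ∈ toggleAll (a ∷ xs) → z ∈ toggleAll (a ∷ xs)
      downClosed-above-x′ {z} {b} (here refl) x<z z≤b b∈ with b ≟ z
      ... | yes refl = b∈
      ... | no  b≢z  = head-toggled-in a-minimal up inv (proj₁ x<z) below
        where
        below : ∀ {p w} → p ∈ toggleAll xs → p ≤ w → w < z → w ∈ toggleAll xs
        below p∈ p≤w (w≤z , _) = closed _ _ _ p∈ (∈-toggle⁻ _≤?_ b≢z b∈) p≤w (≤-trans w≤z z≤b)
      downClosed-above-x′ {z} {b} (there z∈xs) x<z z≤b b∈ =
        ∈-toggle⁺ _≤?_ (∈-tail⇒≢head a-minimal z∈xs)
          (downClosed-above-x z∈xs x<z z≤b (∈-toggle⁻ _≤?_ b≢a b∈))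
        where
        b≢a : b ≢ a
        b≢a refl = All.lookup a-minimal z∈xs z≤b

    x-toggled-in : ∀ {xs} → IsLinearExtension xs → UpClosed xs → x ∈ₗ xs → x ∈ toggleAll xs
    x-toggled-in {_ ∷ xs} (x-minimal ∷ xs-linear) up (here refl) =
      head-toggled-in x-minimal up inv ≤-refl below
      where
      inv = invariant xs-linear (UpClosed-tail x-minimal up)
      open Invariant inv

      below : ∀ {p w} → p ∈ toggleAll xs → p ≤ w → w < x → w ∈ toggleAll xs
      below {p} p∈ p≤w (w≤x , _) with toggled-or-initial p∈
      ... | inj₁ p∈xs = contradiction (≤-trans p≤w w≤x) (All.lookup x-minimal p∈xs)
      ... | inj₂ p∈I  = contradiction (≤-trans p≤w w≤x) (proj₂ (x∥I p p∈I))
    x-toggled-in (a-minimal ∷ xs-linear) up (there x∈xs) =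
      ∈-toggle⁺ _≤?_ (∈-tail⇒≢head a-minimal x∈xs)
        (x-toggled-in xs-linear (UpClosed-tail a-minimal up) x∈xs)

lemma2p19 : {n : ℕ} {ℓ : Level} (_≤_ : Rel (Fin n) ℓ)
            (isPO : IsDecPartialOrder _≡_ _≤_)
            (L : LinearExtension _≤_ (IsDecPartialOrder._≤?_ isPO))
            (I : Subset n) → IntervalClosed _≤_ (IsDecPartialOrder._≤?_ isPO) I →
            (x : Fin n) → (∀ y → y ∈ I → Incomparable _≤_ (IsDecPartialOrder._≤?_ isPO) x y) →
            x ∈ rowmotion _≤_ (IsDecPartialOrder._≤?_ isPO) L I
lemma2p19 _≤_ isPO L I I-closed x x∥I =
  x-toggled-in isPO I I-closed x x∥I
    (linearExtension-isLinearExtension isPO L)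
    (λ _ _ → linearExtension-complete isPO L _)
    (linearExtension-complete isPO L x)
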